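{- If $1\le k\le 5$, then $\Xi(k,2)=k$. If $k\ge 6$, then $$\Xi(k,2)<\Bigl(1+\frac{1}{\sqrt2}\Bigr)(k-2)+\frac14.$$
   Context: All graphs are finite, simple and undirected. For a graph $G=(V,E)$ and $x\in V$, $N[x]=\{x\}\cup\{y: xy\in E\}$; for $X\subseteq V$, $N[X]=\bigcup_{x\in X}N[x]$ (so $N[\emptyset]=\emptyset$). A set $C\subseteq V$ is $(1,\le\ell)$-identifying if $N[X]\cap C\neq N[Y]\cap C$ for all distinct $X,Y\subseteq V$ with $|X|\le\ell$, $|Y|\le\ell$. For $n\ge k\ge1$ and $\ell\ge1$, $\mathfrak{Gr}(n,k,\ell)$ is the set of graphs on $n$ vertices in which every $k$-element subset of vertices is $(1,\le\ell)$-identifying. $\Xi(k,\ell)=\max\{n\ge k:\mathfrak{Gr}(n,k,\ell)\ne\emptyset\}$. -}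

module Defs where

open import Data.Nat using (ℕ; _≤_)
open import Data.Bool using (Bool; true; false; _∨_)
open import Data.Fin using (Fin; _≟_)
open import Data.Fin.Subset using (Subset; _∩_; ∣_∣; ⋃)
open import Data.Fin.Subset.Properties using (_∈?_)
open import Data.List using (List; map; filter; allFin)
open import Data.Vec using (tabulate)
open import Data.Product using (∃)
open import Relation.Nullary using (¬_)
open import Relation.Nullary.Decidable using (⌊_⌋)
open import Relation.Binary.PropositionalEquality using (_≡_; _≢_)

record Graph (n : ℕ) : Set where
  field
    adj    : Fin n → Fin n → Bool
    sym    : ∀ x y → adj x y ≡ adj y x
    irrefl : ∀ x → adj x x ≡ false
open Graph public

N1 : ∀ {n} → Graph n → Fin n → Subset n
N1 G x = tabulate (λ y → ⌊ x ≟ y ⌋ ∨ adj G x y)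

N[_]_ : ∀ {n} → Graph n → Subset n → Subset n
N[_]_ {n} G X = ⋃ (map (N1 G) (filter (_∈? X) (allFin n)))

Identifying : ∀ {n} → Graph n → ℕ → Subset n → Set
Identifying G ℓ C = ∀ (X Y : Subset _) → ∣ X ∣ ≤ ℓ → ∣ Y ∣ ≤ ℓ → X ≢ Y →
  ((N[ G ] X) ∩ C) ≢ ((N[ G ] Y) ∩ C)

InGr : (n k ℓ : ℕ) → Graph n → Set
InGr n k ℓ G = ∀ (C : Subset n) → ∣ C ∣ ≡ k → Identifying G ℓ C

GrNonempty : (n k ℓ : ℕ) → Set
GrNonempty n k ℓ = ∃ λ (G : Graph n) → InGr n k ℓ G

-- Put m = n + 1 − k. In a graph of 𝔊𝔯(n,k,2) any two distinct sets X, Y of at most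
-- two vertices satisfy |N[X] △ N[Y]| ≥ m, for otherwise k vertices outside N[X] △ N[Y]
-- form a code that does not distinguish X from Y. Separating ∅ from {x}, and {y} from
-- {y,x} for a neighbour y of x, gives |N[x]| ≥ m + 2. Separating {x,y} from {x,z} for all
-- ordered pairs y ≠ z needs at least n(n−1)m triples (y,z,c) with c ∉ N[x] splitting y
-- and z; but a vertex c with d closed neighbours splits only 2d(n−d) ≤ n²/2 ordered
-- pairs, and at most n − m − 2 = k − 3 vertices lie outside N[x]. Hence
-- 2nm ≤ n(k−3) + 2m, which is impossible for k ≤ 5 < n, and for k ≥ 6 rearranges to
-- (4m+3)² < 8(k−2)². For k ≤ 5 the edgeless graph on k vertices lies in 𝔊𝔯(k,k,2).

module Submission where

open import Defs hiding (sym)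
open import Data.Bool using (Bool; true; false; not; _∧_; _∨_; _xor_)
open import Data.Bool.Properties using (∧-zeroʳ)
open import Data.Empty using (⊥-elim)
open import Data.Fin using (Fin; zero; suc; punchIn; _≟_)
open import Data.Fin.Properties using (punchInᵢ≢i; punchIn-punchOut; nonZeroIndex)
open import Data.Fin.Subset using (Subset; _∈_; _∪_; _∩_; ⁅_⁆; ⋃; ∣_∣; ⊤) renaming (⊥ to ∅)
open import Data.Fin.Subset.Properties
  using (_∈?_; ∉⊥; x∈p∪q⁺; x∈p∪q⁻; x∈⁅x⁆; x∈⁅y⁆⇒x≡y; ∣⁅x⁆∣≡1; ∣⊥∣≡0; ∣p∣≤∣x∷p∣; ∣p∣≡n⇒p≡⊤;
         ⊆-antisym; ⊆-min; ∩-identityʳ)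
open import Data.List using (List; []; _∷_; map; filter; allFin)
open import Data.List.Membership.Propositional using () renaming (_∈_ to _∈ₗ_)
open import Data.List.Membership.Propositional.Properties
  using (∈-map⁺; ∈-map⁻; ∈-filter⁺; ∈-filter⁻; ∈-allFin)
open import Data.List.Relation.Unary.Any using (here; there)
open import Data.Nat hiding (_≟_)
open import Data.Nat.Properties hiding (_≟_)
open import Algebra.Properties.Semiring.Sum +-*-semiring
  using (sum; sum-cong-≗; sum-remove; ∑-distrib-+; ∑-comm; *-distribˡ-sum; *-distribʳ-sum)
open import Data.Nat.Tactic.RingSolver using (solve-∀)
open import Data.Product using (∃; _×_; _,_; proj₁; proj₂)
open import Data.Sum using (_⊎_; inj₁; inj₂; [_,_]′)
open import Data.Vec using (_∷_; []; lookup)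
open import Data.Vec.Properties
  using (lookup∘tabulate; lookup-zipWith; lookup-replicate; []=⇒lookup; lookup⇒[]=)
open import Function using (_∘_)
open import Relation.Nullary using (¬_; yes; no; contradiction)
open import Relation.Nullary.Decidable using (⌊_⌋; isYes≗does; dec-true; dec-false)
open import Relation.Binary.PropositionalEquality

-- Counting

indicator : Bool → ℕ
indicator true  = 1
indicator false = 0

indicator≤1 : ∀ a → indicator a ≤ 1
indicator≤1 true  = ≤-refl
indicator≤1 false = z≤n

indicator-∧ : ∀ a b → indicator (a ∧ b) ≡ indicator a * indicator b
indicator-∧ true  b = sym (+-identityʳ (indicator b))
indicator-∧ false b = refl

indicator-split : ∀ a b → indicator a ≡ indicator (a ∧ b) + indicator (a ∧ not b)
indicator-split true  true  = refl
indicator-split true  false = refl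
indicator-split false b     = refl

indicator-not : ∀ a → indicator a + indicator (not a) ≡ 1
indicator-not true  = refl
indicator-not false = refl

indicator-xor : ∀ a b →
  indicator (a xor b) ≡ indicator a * indicator (not b) + indicator (not a) * indicator b
indicator-xor true  true  = refl
indicator-xor true  false = refl
indicator-xor false true  = refl
indicator-xor false false = refl

sum-mono-≤ : ∀ {n} {f g : Fin n → ℕ} → (∀ i → f i ≤ g i) → sum f ≤ sum g
sum-mono-≤ {zero}  f≤g = z≤n
sum-mono-≤ {suc n} f≤g = +-mono-≤ (f≤g zero) (sum-mono-≤ (f≤g ∘ suc))

sum-const : ∀ n c → sum {n} (λ _ → c) ≡ n * c
sum-const zero    c = refl
sum-const (suc n) c = cong (c +_) (sum-const n c)

sum-≥-except : ∀ {n m} (f : Fin n → ℕ) i → (∀ j → j ≢ i → m ≤ f j) → n * m ≤ sum f + m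
sum-≥-except {suc n} {m} f i f≥m = begin
  m + n * m                      ≡⟨ +-comm m (n * m) ⟩
  n * m + m                      ≡⟨ cong (_+ m) (sym (sum-const n m)) ⟩
  sum {n} (λ _ → m) + m          ≤⟨ +-monoˡ-≤ m (sum-mono-≤ λ j → f≥m (punchIn i j) (punchInᵢ≢i i j)) ⟩
  sum (f ∘ punchIn i) + m        ≤⟨ +-monoˡ-≤ m (m≤n+m _ (f i)) ⟩
  f i + sum (f ∘ punchIn i) + m  ≡⟨ cong (_+ m) (sym (sum-remove f)) ⟩
  sum f + m                      ∎
  where open ≤-Reasoning

count : ∀ {n} → (Fin n → Bool) → ℕ
count f = sum (indicator ∘ f)

count-cong : ∀ {n} {f g : Fin n → Bool} → (∀ i → f i ≡ g i) → count f ≡ count g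
count-cong f≗g = sum-cong-≗ (cong indicator ∘ f≗g)

count-split : ∀ {n} (f g : Fin n → Bool) →
  count f ≡ count (λ i → f i ∧ g i) + count (λ i → f i ∧ not (g i))
count-split f g = trans (sum-cong-≗ λ i → indicator-split (f i) (g i))
  (∑-distrib-+ (λ i → indicator (f i ∧ g i)) (λ i → indicator (f i ∧ not (g i))))

count-complement : ∀ {n} (f : Fin n → Bool) → count f + count (not ∘ f) ≡ n
count-complement {n} f = begin
  count f + count (not ∘ f)                            ≡⟨ ∑-distrib-+ (indicator ∘ f) (indicator ∘ not ∘ f) ⟨
  sum (λ i → indicator (f i) + indicator (not (f i)))  ≡⟨ sum-cong-≗ (indicator-not ∘ f) ⟩
  sum {n} (λ _ → 1)                                    ≡⟨ sum-const n 1 ⟩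
  n * 1                                                ≡⟨ *-identityʳ n ⟩
  n                                                    ∎
  where open ≡-Reasoning

count-not : ∀ {n} (f : Fin n → Bool) → count (not ∘ f) ≡ n ∸ count f
count-not f = trans (sym (m+n∸m≡n (count f) _)) (cong (_∸ count f) (count-complement f))

count-remove : ∀ {n} (f : Fin (suc n) → Bool) i → count f ≡ indicator (f i) + count (f ∘ punchIn i)
count-remove f i = sum-remove (indicator ∘ f)

0<count⇒∃ : ∀ {n} (f : Fin n → Bool) → 1 ≤ count f → ∃ λ i → f i ≡ true
0<count⇒∃ {suc n} f 1≤cf with f zero in f0
... | true  = zero , f0
... | false = let i , fi = 0<count⇒∃ (f ∘ suc) 1≤cf in suc i , fi

∃⇒0<count : ∀ {n} (f : Fin n → Bool) {i} → f i ≡ true → 1 ≤ count f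
∃⇒0<count {suc n} f {i} fi rewrite count-remove f i | fi = s≤s z≤n

2≤count : ∀ {n} (f : Fin n → Bool) {i j} → f i ≡ true → f j ≡ true → i ≢ j → 2 ≤ count f
2≤count {suc n} f {i} fi fj i≢j rewrite count-remove f i | fi =
  s≤s (∃⇒0<count (f ∘ punchIn i) (subst (λ v → f v ≡ true) (sym (punchIn-punchOut i≢j)) fj))

2≤count⇒∃≢ : ∀ {n} (f : Fin n → Bool) → 2 ≤ count f → ∀ i → ∃ λ j → j ≢ i × f j ≡ true
2≤count⇒∃≢ {suc n} f 2≤cf i =
  let j , fj = 0<count⇒∃ (f ∘ punchIn i) 1≤rest in punchIn i j , punchInᵢ≢i i j , fj
  where
  1≤rest : 1 ≤ count (f ∘ punchIn i)
  1≤rest = +-cancelˡ-≤ 1 1 _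
    (≤-trans 2≤cf (≤-trans (≤-reflexive (count-remove f i)) (+-monoˡ-≤ _ (indicator≤1 (f i)))))

subset-of-size : ∀ {n} (f : Fin n → Bool) {k} → k ≤ count f →
  ∃ λ (C : Subset n) → ∣ C ∣ ≡ k × (∀ c → lookup C c ≡ true → f c ≡ true)
subset-of-size {zero}  f z≤n = [] , refl , λ ()
subset-of-size {suc n} f {k} k≤cf with f zero in f0 | k | k≤cf
... | false | _     | k≤cf′     = let C , ∣C∣ , C⊆f = subset-of-size (f ∘ suc) k≤cf′ in
                                   false ∷ C , ∣C∣ , λ { (suc c) → C⊆f c }
... | true  | zero  | _         = let C , ∣C∣ , C⊆f = subset-of-size (f ∘ suc) z≤n in
                                   false ∷ C , ∣C∣ , λ { (suc c) → C⊆f c }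
... | true  | suc k | s≤s k≤cf′ = let C , ∣C∣ , C⊆f = subset-of-size (f ∘ suc) k≤cf′ in
                                   true ∷ C , cong suc ∣C∣ , λ { zero _ → f0 ; (suc c) → C⊆f c }

am-gm : ∀ d e → 4 * d * e ≤ (d + e) * (d + e)
am-gm d e = [ ordered , (λ e≤d → subst₂ _≤_ (*-comm-4 e d) (+-comm-square e d) (ordered e≤d)) ]′
               (≤-total d e)
  where
  *-comm-4 : ∀ a b → 4 * a * b ≡ 4 * b * a
  *-comm-4 = solve-∀
  +-comm-square : ∀ a b → (a + b) * (a + b) ≡ (b + a) * (b + a)
  +-comm-square = solve-∀
  square : ∀ a t → 4 * a * (a + t) + t * t ≡ (a + (a + t)) * (a + (a + t))
  square = solve-∀
  ordered : ∀ {a b} → a ≤ b → 4 * a * b ≤ (a + b) * (a + b)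
  ordered {a} a≤b with m≤n⇒∃[o]m+o≡n a≤b
  ... | t , refl = ≤-trans (m≤m+n _ (t * t)) (≤-reflexive (square a t))

∑∑-xor : ∀ {n} (h : Fin n → Bool) →
  sum (λ y → sum (λ z → indicator (h y xor h z))) ≡ count h * count (not ∘ h) + count (not ∘ h) * count h
∑∑-xor h = begin
  sum (λ y → sum (λ z → indicator (h y xor h z)))
    ≡⟨ sum-cong-≗ row ⟩
  sum (λ y → indicator (h y) * count (not ∘ h) + indicator (not (h y)) * count h)
    ≡⟨ ∑-distrib-+ (λ y → indicator (h y) * count (not ∘ h)) (λ y → indicator (not (h y)) * count h) ⟩
  sum (λ y → indicator (h y) * count (not ∘ h)) + sum (λ y → indicator (not (h y)) * count h)
    ≡⟨ sym (cong₂ _+_ (*-distribʳ-sum (count (not ∘ h)) (indicator ∘ h))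
                      (*-distribʳ-sum (count h) (indicator ∘ not ∘ h))) ⟩
  count h * count (not ∘ h) + count (not ∘ h) * count h
    ∎
  where
  open ≡-Reasoning
  row : ∀ y → sum (λ z → indicator (h y xor h z)) ≡
              indicator (h y) * count (not ∘ h) + indicator (not (h y)) * count h
  row y = begin
    sum (λ z → indicator (h y xor h z))
      ≡⟨ sum-cong-≗ (indicator-xor (h y) ∘ h) ⟩
    sum (λ z → indicator (h y) * indicator (not (h z)) + indicator (not (h y)) * indicator (h z))
      ≡⟨ ∑-distrib-+ (λ z → indicator (h y) * indicator (not (h z)))
                     (λ z → indicator (not (h y)) * indicator (h z)) ⟩
    sum (λ z → indicator (h y) * indicator (not (h z)))
      + sum (λ z → indicator (not (h y)) * indicator (h z))
      ≡⟨ sym (cong₂ _+_ (*-distribˡ-sum (indicator (h y)) (indicator ∘ not ∘ h))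
                        (*-distribˡ-sum (indicator (not (h y))) (indicator ∘ h))) ⟩
    indicator (h y) * count (not ∘ h) + indicator (not (h y)) * count h
      ∎

2*∑∑-xor≤ : ∀ {n} (h : Fin n → Bool) → 2 * sum (λ y → sum (λ z → indicator (h y xor h z))) ≤ n * n
2*∑∑-xor≤ {n} h = begin
  2 * sum (λ y → sum (λ z → indicator (h y xor h z)))  ≡⟨ cong (2 *_) (∑∑-xor h) ⟩
  2 * (d * e + e * d)                                   ≡⟨ double d e ⟩
  4 * d * e                                             ≤⟨ am-gm d e ⟩
  (d + e) * (d + e)                                     ≡⟨ cong (λ s → s * s) (count-complement h) ⟩
  n * n                                                 ∎
  where
  open ≤-Reasoning
  d = count h
  e = count (not ∘ h)
  double : ∀ a b → 2 * (a * b + b * a) ≡ 4 * a * b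
  double = solve-∀

-- Each c with g c splits 2d(n−d) ≤ n²/2 ordered pairs (y,z), where d = #{y | f y c}.
2*∑∑-count-xor≤ : ∀ {n} (g : Fin n → Bool) (f : Fin n → Fin n → Bool) →
  2 * sum (λ y → sum (λ z → count (λ c → g c ∧ (f y c xor f z c)))) ≤ n * n * count g
2*∑∑-count-xor≤ {n} g f = begin
  2 * sum (λ y → sum (λ z → count (λ c → g c ∧ (f y c xor f z c))))
    ≡⟨ cong (2 *_) (sum-cong-≗ λ y → sum-cong-≗ λ z → sum-cong-≗ λ c → indicator-∧ (g c) (f y c xor f z c)) ⟩
  2 * sum (λ y → sum (λ z → sum (λ c → a c * splits y z c)))
    ≡⟨ cong (2 *_) (sum-cong-≗ λ y → ∑-comm (λ z c → a c * splits y z c)) ⟩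
  2 * sum (λ y → sum (λ c → sum (λ z → a c * splits y z c)))
    ≡⟨ cong (2 *_) (∑-comm (λ y c → sum (λ z → a c * splits y z c))) ⟩
  2 * sum (λ c → sum (λ y → sum (λ z → a c * splits y z c)))
    ≡⟨ cong (2 *_) (sum-cong-≗ λ c → sym (factor c)) ⟩
  2 * sum (λ c → a c * pairs c)
    ≡⟨ *-distribˡ-sum 2 (λ c → a c * pairs c) ⟩
  sum (λ c → 2 * (a c * pairs c))
    ≡⟨ sum-cong-≗ (λ c → *-comm-middle (a c) (pairs c)) ⟩
  sum (λ c → a c * (2 * pairs c))
    ≤⟨ sum-mono-≤ (λ c → *-monoʳ-≤ (a c) (2*∑∑-xor≤ (λ y → f y c))) ⟩
  sum (λ c → a c * (n * n))
    ≡⟨ *-distribʳ-sum (n * n) a ⟨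
  count g * (n * n)
    ≡⟨ *-comm (count g) (n * n) ⟩
  n * n * count g
    ∎
  where
  open ≤-Reasoning
  a : Fin n → ℕ
  a = indicator ∘ g
  splits : Fin n → Fin n → Fin n → ℕ
  splits y z c = indicator (f y c xor f z c)
  pairs : Fin n → ℕ
  pairs c = sum (λ y → sum (λ z → splits y z c))
  factor : ∀ c → a c * pairs c ≡ sum (λ y → sum (λ z → a c * splits y z c))
  factor c = trans (*-distribˡ-sum (a c) (λ y → sum (λ z → splits y z c)))
                   (sum-cong-≗ λ y → *-distribˡ-sum (a c) (λ z → splits y z c))
  *-comm-middle : ∀ p q → 2 * (p * q) ≡ p * (2 * q)
  *-comm-middle = solve-∀

-- Closed neighbourhoods

≟-refl : ∀ {n} (x : Fin n) → ⌊ x ≟ x ⌋ ≡ true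
≟-refl x = trans (isYes≗does (x ≟ x)) (dec-true (x ≟ x) refl)

≟-sym : ∀ {n} (x y : Fin n) → ⌊ x ≟ y ⌋ ≡ ⌊ y ≟ x ⌋
≟-sym x y with x ≟ y
... | yes refl = sym (≟-refl x)
... | no x≢y   = sym (trans (isYes≗does (y ≟ x)) (dec-false (y ≟ x) (x≢y ∘ sym)))

∣p∪q∣≤∣p∣+∣q∣ : ∀ {n} (p q : Subset n) → ∣ p ∪ q ∣ ≤ ∣ p ∣ + ∣ q ∣
∣p∪q∣≤∣p∣+∣q∣ []           []           = z≤n
∣p∪q∣≤∣p∣+∣q∣ (true  ∷ p)  (t ∷ q)      =
  s≤s (≤-trans (∣p∪q∣≤∣p∣+∣q∣ p q) (+-monoʳ-≤ ∣ p ∣ (∣p∣≤∣x∷p∣ t q)))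
∣p∪q∣≤∣p∣+∣q∣ (false ∷ p)  (true  ∷ q)  =
  ≤-trans (s≤s (∣p∪q∣≤∣p∣+∣q∣ p q)) (≤-reflexive (sym (+-suc ∣ p ∣ ∣ q ∣)))
∣p∪q∣≤∣p∣+∣q∣ (false ∷ p)  (false ∷ q)  = ∣p∪q∣≤∣p∣+∣q∣ p q

∣⁅x⁆∪⁅y⁆∣≤2 : ∀ {n} (x y : Fin n) → ∣ ⁅ x ⁆ ∪ ⁅ y ⁆ ∣ ≤ 2
∣⁅x⁆∪⁅y⁆∣≤2 x y = ≤-trans (∣p∪q∣≤∣p∣+∣q∣ ⁅ x ⁆ ⁅ y ⁆) (≤-reflexive (cong₂ _+_ (∣⁅x⁆∣≡1 x) (∣⁅x⁆∣≡1 y)))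

∈⁅x⁆∪⁅y⁆⁻ : ∀ {n} {x y c : Fin n} → c ∈ ⁅ x ⁆ ∪ ⁅ y ⁆ → c ≡ x ⊎ c ≡ y
∈⁅x⁆∪⁅y⁆⁻ {x = x} {y} c∈ with x∈p∪q⁻ ⁅ x ⁆ ⁅ y ⁆ c∈
... | inj₁ c∈⁅x⁆ = inj₁ (x∈⁅y⁆⇒x≡y x c∈⁅x⁆)
... | inj₂ c∈⁅y⁆ = inj₂ (x∈⁅y⁆⇒x≡y y c∈⁅y⁆)

⁅x⁆∪-injective : ∀ {n} {x y z : Fin n} → ⁅ x ⁆ ∪ ⁅ y ⁆ ≡ ⁅ x ⁆ ∪ ⁅ z ⁆ → y ≡ z
⁅x⁆∪-injective {x = x} {y} {z} eq
  with ∈⁅x⁆∪⁅y⁆⁻ (subst (y ∈_) eq (x∈p∪q⁺ (inj₂ (x∈⁅x⁆ y))))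
     | ∈⁅x⁆∪⁅y⁆⁻ (subst (z ∈_) (sym eq) (x∈p∪q⁺ (inj₂ (x∈⁅x⁆ z))))
... | inj₂ y≡z | _        = y≡z
... | _        | inj₂ z≡y = sym z≡y
... | inj₁ y≡x | inj₁ z≡x = trans y≡x (sym z≡x)

∈-⋃⁻ : ∀ {n} {c : Fin n} (Ss : List (Subset n)) → c ∈ ⋃ Ss → ∃ λ S → S ∈ₗ Ss × c ∈ S
∈-⋃⁻ []       c∈ = ⊥-elim (∉⊥ c∈)
∈-⋃⁻ (S ∷ Ss) c∈ with x∈p∪q⁻ S (⋃ Ss) c∈
... | inj₁ c∈S  = S , here refl , c∈S
... | inj₂ c∈⋃ = let T , T∈ , c∈T = ∈-⋃⁻ Ss c∈⋃ in T , there T∈ , c∈T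

∈-⋃⁺ : ∀ {n} {c : Fin n} {S} {Ss : List (Subset n)} → S ∈ₗ Ss → c ∈ S → c ∈ ⋃ Ss
∈-⋃⁺ (here refl) c∈S = x∈p∪q⁺ (inj₁ c∈S)
∈-⋃⁺ (there S∈)  c∈S = x∈p∪q⁺ (inj₂ (∈-⋃⁺ S∈ c∈S))

module _ {n} (G : Graph n) where

  closedAdj : Fin n → Fin n → Bool
  closedAdj x = lookup (N1 G x)

  closedAdj-def : ∀ x y → closedAdj x y ≡ ⌊ x ≟ y ⌋ ∨ adj G x y
  closedAdj-def x y = lookup∘tabulate _ y

  closedAdj-refl : ∀ x → closedAdj x x ≡ true
  closedAdj-refl x = trans (closedAdj-def x x) (cong (_∨ adj G x x) (≟-refl x))

  closedAdj-sym : ∀ x y → closedAdj x y ≡ closedAdj y x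
  closedAdj-sym x y = begin
    closedAdj x y             ≡⟨ closedAdj-def x y ⟩
    ⌊ x ≟ y ⌋ ∨ adj G x y     ≡⟨ cong₂ _∨_ (≟-sym x y) (Graph.sym G x y) ⟩
    ⌊ y ≟ x ⌋ ∨ adj G y x     ≡⟨ closedAdj-def y x ⟨
    closedAdj y x             ∎
    where open ≡-Reasoning

  ∈-N⁻ : ∀ {X c} → c ∈ N[ G ] X → ∃ λ v → v ∈ X × c ∈ N1 G v
  ∈-N⁻ {X} c∈ with ∈-⋃⁻ (map (N1 G) (filter (_∈? X) (allFin n))) c∈
  ... | S , S∈ , c∈S with ∈-map⁻ (N1 G) S∈
  ...   | v , v∈ , refl = v , proj₂ (∈-filter⁻ (_∈? X) {xs = allFin n} v∈) , c∈S

  ∈-N⁺ : ∀ {X c v} → v ∈ X → c ∈ N1 G v → c ∈ N[ G ] X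
  ∈-N⁺ {X} {v = v} v∈X = ∈-⋃⁺ (∈-map⁺ (N1 G) (∈-filter⁺ (_∈? X) (∈-allFin v) v∈X))

  N-∪ : ∀ X Y → N[ G ] (X ∪ Y) ≡ N[ G ] X ∪ N[ G ] Y
  N-∪ X Y = ⊆-antisym ⊆ ⊇
    where
    ⊆ : ∀ {c} → c ∈ N[ G ] (X ∪ Y) → c ∈ N[ G ] X ∪ N[ G ] Y
    ⊆ c∈ with ∈-N⁻ c∈
    ... | v , v∈X∪Y , c∈Nv with x∈p∪q⁻ X Y v∈X∪Y
    ...   | inj₁ v∈X = x∈p∪q⁺ (inj₁ (∈-N⁺ v∈X c∈Nv))
    ...   | inj₂ v∈Y = x∈p∪q⁺ (inj₂ (∈-N⁺ v∈Y c∈Nv))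
    ⊇ : ∀ {c} → c ∈ N[ G ] X ∪ N[ G ] Y → c ∈ N[ G ] (X ∪ Y)
    ⊇ c∈ with x∈p∪q⁻ (N[ G ] X) (N[ G ] Y) c∈
    ... | inj₁ c∈NX = let v , v∈X , c∈Nv = ∈-N⁻ c∈NX in ∈-N⁺ (x∈p∪q⁺ (inj₁ v∈X)) c∈Nv
    ... | inj₂ c∈NY = let v , v∈Y , c∈Nv = ∈-N⁻ c∈NY in ∈-N⁺ (x∈p∪q⁺ (inj₂ v∈Y)) c∈Nv

  N-⁅⁆ : ∀ x → N[ G ] ⁅ x ⁆ ≡ N1 G x
  N-⁅⁆ x = ⊆-antisym ⊆ (∈-N⁺ (x∈⁅x⁆ x))
    where
    ⊆ : ∀ {c} → c ∈ N[ G ] ⁅ x ⁆ → c ∈ N1 G x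
    ⊆ c∈ with ∈-N⁻ c∈
    ... | v , v∈⁅x⁆ , c∈Nv = subst (λ w → _ ∈ N1 G w) (x∈⁅y⁆⇒x≡y x v∈⁅x⁆) c∈Nv

  N-∅ : N[ G ] ∅ ≡ ∅
  N-∅ = ⊆-antisym (λ c∈ → ⊥-elim (∉⊥ (proj₁ (proj₂ (∈-N⁻ c∈))))) (⊆-min _)

  lookup-N-⁅⁆∪⁅⁆ : ∀ x y c → lookup (N[ G ] (⁅ x ⁆ ∪ ⁅ y ⁆)) c ≡ closedAdj x c ∨ closedAdj y c
  lookup-N-⁅⁆∪⁅⁆ x y c rewrite N-∪ ⁅ x ⁆ ⁅ y ⁆ | N-⁅⁆ x | N-⁅⁆ y = lookup-zipWith _∨_ c (N1 G x) (N1 G y)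

  lookup-N-⁅⁆ : ∀ x c → lookup (N[ G ] ⁅ x ⁆) c ≡ closedAdj x c
  lookup-N-⁅⁆ x c = cong (λ S → lookup S c) (N-⁅⁆ x)

  lookup-N-∅ : ∀ c → lookup (N[ G ] ∅) c ≡ false
  lookup-N-∅ c = trans (cong (λ S → lookup S c) N-∅) (lookup-replicate c false)

edgeless : ∀ n → Graph n
edgeless n = record { adj = λ _ _ → false ; sym = λ _ _ → refl ; irrefl = λ _ → refl }

closedAdj-edgeless⇒≡ : ∀ {n} {x y : Fin n} → closedAdj (edgeless n) x y ≡ true → x ≡ y
closedAdj-edgeless⇒≡ {x = x} {y} x~y with x ≟ y | trans (sym (closedAdj-def (edgeless _) x y)) x~y
... | yes x≡y | _ = x≡y
... | no _    | ()

N-edgeless : ∀ {n} (X : Subset n) → N[ edgeless n ] X ≡ X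
N-edgeless {n} X =
  ⊆-antisym ⊆ (λ {c} c∈X → ∈-N⁺ (edgeless n) c∈X (lookup⇒[]= c _ (closedAdj-refl (edgeless n) c)))
  where
  ⊆ : ∀ {c} → c ∈ N[ edgeless n ] X → c ∈ X
  ⊆ c∈ with ∈-N⁻ (edgeless n) c∈
  ... | v , v∈X , c∈Nv = subst (_∈ X) (closedAdj-edgeless⇒≡ ([]=⇒lookup c∈Nv)) v∈X

edgeless∈Gr : ∀ k → InGr k k 2 (edgeless k)
edgeless∈Gr k C ∣C∣≡k X Y _ _ X≢Y NX∩C≡NY∩C = X≢Y (begin
  X                             ≡⟨ ∩-identityʳ X ⟨
  X ∩ ⊤                         ≡⟨ cong₂ _∩_ (N-edgeless X) C≡⊤ ⟨
  (N[ edgeless k ] X) ∩ C       ≡⟨ NX∩C≡NY∩C ⟩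
  (N[ edgeless k ] Y) ∩ C       ≡⟨ cong₂ _∩_ (N-edgeless Y) C≡⊤ ⟩
  Y ∩ ⊤                         ≡⟨ ∩-identityʳ Y ⟩
  Y                             ∎)
  where
  open ≡-Reasoning
  C≡⊤ : C ≡ ⊤
  C≡⊤ = ∣p∣≡n⇒p≡⊤ ∣C∣≡k

-- Separation by at least m vertices

∨-xor-∨ : ∀ a b c → (a ∨ b) xor (a ∨ c) ≡ not a ∧ (b xor c)
∨-xor-∨ true  b c = refl
∨-xor-∨ false b c = refl

not-∧-xor : ∀ a b → not a ∧ (a xor b) ≡ b ∧ not a
not-∧-xor true  b     = sym (∧-zeroʳ b)
not-∧-xor false true  = refl
not-∧-xor false false = refl

not-xor⇒≡ : ∀ a b → not (a xor b) ≡ true → a ≡ b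
not-xor⇒≡ true  true  _ = refl
not-xor⇒≡ false false _ = refl

separates : ∀ {n} → Graph n → Subset n → Subset n → Fin n → Bool
separates G X Y c = lookup (N[ G ] X) c xor lookup (N[ G ] Y) c

Separating : ∀ {n} → Graph n → ℕ → Set
Separating G m = ∀ X Y → ∣ X ∣ ≤ 2 → ∣ Y ∣ ≤ 2 → X ≢ Y → m ≤ count (separates G X Y)

∩-agree : ∀ {n} (A B C : Subset n) → (∀ c → lookup C c ≡ true → lookup A c ≡ lookup B c) → A ∩ C ≡ B ∩ C
∩-agree []      []      []          _     = refl
∩-agree (a ∷ A) (b ∷ B) (true  ∷ C) agree =
  cong₂ _∷_ (cong (_∧ true) (agree zero refl)) (∩-agree A B C (agree ∘ suc))
∩-agree (a ∷ A) (b ∷ B) (false ∷ C) agree =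
  cong₂ _∷_ (trans (∧-zeroʳ a) (sym (∧-zeroʳ b))) (∩-agree A B C (agree ∘ suc))

InGr⇒Separating : ∀ {n k m} (G : Graph n) → InGr n k 2 G → m + k ≡ suc n → Separating G m
InGr⇒Separating {n} {k} {m} G G∈Gr m+k≡1+n X Y ∣X∣≤2 ∣Y∣≤2 X≢Y with m ≤? count (separates G X Y)
... | yes m≤ = m≤
... | no m≰ =
  let C , ∣C∣≡k , C⊆agree = subset-of-size (not ∘ separates G X Y) k≤
  in contradiction (∩-agree _ _ C λ c c∈C → not-xor⇒≡ _ _ (C⊆agree c c∈C))
                   (G∈Gr C ∣C∣≡k X Y ∣X∣≤2 ∣Y∣≤2 X≢Y)
  where
  open ≤-Reasoning
  s = count (separates G X Y)
  k≤ : k ≤ count (not ∘ separates G X Y)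
  k≤ = +-cancelˡ-≤ s k _ (≤-pred (begin
    suc s + k                                  ≤⟨ +-monoˡ-≤ k (≰⇒> m≰) ⟩
    m + k                                      ≡⟨ m+k≡1+n ⟩
    suc n                                      ≡⟨ cong suc (count-complement (separates G X Y)) ⟨
    suc (s + count (not ∘ separates G X Y))    ∎))

module _ {n} (G : Graph n) {m} (sep : Separating G m) where

  separated-pairs : ∀ x {y z} → y ≢ z →
    m ≤ count (λ c → not (closedAdj G x c) ∧ (closedAdj G y c xor closedAdj G z c))
  separated-pairs x {y} {z} y≢z = subst (m ≤_) (count-cong pointwise)
    (sep (⁅ x ⁆ ∪ ⁅ y ⁆) (⁅ x ⁆ ∪ ⁅ z ⁆) (∣⁅x⁆∪⁅y⁆∣≤2 x y) (∣⁅x⁆∪⁅y⁆∣≤2 x z) (y≢z ∘ ⁅x⁆∪-injective))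
    where
    pointwise : ∀ c → separates G (⁅ x ⁆ ∪ ⁅ y ⁆) (⁅ x ⁆ ∪ ⁅ z ⁆) c ≡
                      not (closedAdj G x c) ∧ (closedAdj G y c xor closedAdj G z c)
    pointwise c = trans (cong₂ _xor_ (lookup-N-⁅⁆∪⁅⁆ G x y c) (lookup-N-⁅⁆∪⁅⁆ G x z c))
                        (∨-xor-∨ (closedAdj G x c) (closedAdj G y c) (closedAdj G z c))

  m≤closedNbhd : ∀ x → m ≤ count (closedAdj G x)
  m≤closedNbhd x = subst (m ≤_) (count-cong λ c → cong₂ _xor_ (lookup-N-∅ G c) (lookup-N-⁅⁆ G x c))
    (sep ∅ ⁅ x ⁆ (≤-trans (≤-reflexive (∣⊥∣≡0 n)) z≤n) (≤-trans (≤-reflexive (∣⁅x⁆∣≡1 x)) (s≤s z≤n))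
         (λ ∅≡⁅x⁆ → ∉⊥ (subst (x ∈_) (sym ∅≡⁅x⁆) (x∈⁅x⁆ x))))

  -- With y ≠ x in N[x]: only N[x] ∖ N[y] separates {y} from {y,x}, and N[x] ∩ N[y] ∋ x, y.
  m+2≤closedNbhd : 2 ≤ m → ∀ x → m + 2 ≤ count (closedAdj G x)
  m+2≤closedNbhd 2≤m x with 2≤count⇒∃≢ (closedAdj G x) (≤-trans 2≤m (m≤closedNbhd x)) x
  ... | y , y≢x , x~y = begin
    m + 2                          ≤⟨ +-mono-≤ private-part common ⟩
    private-count + common-count   ≡⟨ +-comm private-count common-count ⟩
    common-count + private-count   ≡⟨ count-split (N x) (N y) ⟨
    count (N x)                    ∎
    where
    open ≤-Reasoning
    N = closedAdj G
    private-count = count (λ c → N x c ∧ not (N y c))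
    common-count = count (λ c → N x c ∧ N y c)
    private-part : m ≤ private-count
    private-part = subst (m ≤_) (count-cong λ c → not-∧-xor (N y c) (N x c)) (separated-pairs y y≢x)
    common : 2 ≤ common-count
    common = 2≤count _ (cong₂ _∧_ (closedAdj-refl G x) (trans (closedAdj-sym G y x) x~y))
                       (cong₂ _∧_ x~y (closedAdj-refl G y)) (y≢x ∘ sym)

  2nm≤n*nonNbrs+2m : ∀ x → 2 * n * m ≤ n * count (not ∘ closedAdj G x) + 2 * m
  2nm≤n*nonNbrs+2m x = *-cancelˡ-≤ n {{nonZeroIndex x}} (begin
    n * (2 * n * m)                  ≡⟨ reassoc n m ⟩
    2 * (n * (n * m))                ≤⟨ *-monoʳ-≤ 2 lower ⟩
    2 * (S + n * m)                  ≡⟨ *-distribˡ-+ 2 S (n * m) ⟩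
    2 * S + 2 * (n * m)              ≤⟨ +-monoˡ-≤ (2 * (n * m)) upper ⟩
    n * n * e + 2 * (n * m)          ≡⟨ factor-n n e m ⟩
    n * (n * e + 2 * m)              ∎)
    where
    open ≤-Reasoning
    N = closedAdj G
    e = count (not ∘ N x)
    row : Fin n → Fin n → ℕ
    row y z = count (λ c → not (N x c) ∧ (N y c xor N z c))
    S = sum (λ y → sum (row y))
    lower : n * (n * m) ≤ S + n * m
    lower = begin
      n * (n * m)                  ≡⟨ sum-const n (n * m) ⟨
      sum {n} (λ _ → n * m)
        ≤⟨ sum-mono-≤ (λ y → sum-≥-except (row y) y λ z z≢y → separated-pairs x (z≢y ∘ sym)) ⟩
      sum (λ y → sum (row y) + m)  ≡⟨ ∑-distrib-+ (λ y → sum (row y)) (λ _ → m) ⟩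
      S + sum {n} (λ _ → m)        ≡⟨ cong (S +_) (sum-const n m) ⟩
      S + n * m                    ∎
    upper : 2 * S ≤ n * n * e
    upper = 2*∑∑-count-xor≤ (not ∘ N x) N
    reassoc : ∀ n m → n * (2 * n * m) ≡ 2 * (n * (n * m))
    reassoc = solve-∀
    factor-n : ∀ n e m → n * n * e + 2 * (n * m) ≡ n * (n * e + 2 * m)
    factor-n = solve-∀

counting-bound : ∀ {n k m} (G : Graph n) → InGr n k 2 G → m + k ≡ suc n → 2 ≤ m →
  m + 2 ≤ n × 2 * n * m ≤ n * (k ∸ 3) + 2 * m
counting-bound {zero} {k} {m} _ _ m+k≡1 2≤m =
  contradiction (≤-trans 2≤m (≤-trans (m≤m+n m k) (≤-reflexive m+k≡1))) λ { (s≤s ()) }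
counting-bound {suc n} {k} {m} G G∈Gr m+k≡2+n 2≤m = m+2≤1+n , (begin
  2 * suc n * m                                   ≤⟨ 2nm≤n*nonNbrs+2m G sep zero ⟩
  suc n * count (not ∘ closedAdj G zero) + 2 * m  ≤⟨ +-monoˡ-≤ (2 * m) (*-monoʳ-≤ (suc n) nonNbrs≤k∸3) ⟩
  suc n * (k ∸ 3) + 2 * m                         ∎)
  where
  open ≤-Reasoning
  sep : Separating G m
  sep = InGr⇒Separating G G∈Gr m+k≡2+n
  m+2≤nbrs : m + 2 ≤ count (closedAdj G zero)
  m+2≤nbrs = m+2≤closedNbhd G sep 2≤m zero
  m+2≤1+n : m + 2 ≤ suc n
  m+2≤1+n = ≤-trans m+2≤nbrs (≤-trans (m≤m+n _ _) (≤-reflexive (count-complement (closedAdj G zero))))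
  nonNbrs≤k∸3 : count (not ∘ closedAdj G zero) ≤ k ∸ 3
  nonNbrs≤k∸3 = begin
    count (not ∘ closedAdj G zero)  ≡⟨ count-not (closedAdj G zero) ⟩
    suc n ∸ count (closedAdj G zero) ≤⟨ ∸-monoʳ-≤ (suc n) m+2≤nbrs ⟩
    suc (suc n) ∸ suc (m + 2)        ≡⟨ cong₂ _∸_ m+k≡2+n (+-suc m 2) ⟨
    (m + k) ∸ (m + 3)                ≡⟨ [m+n]∸[m+o]≡n∸o m k 3 ⟩
    k ∸ 3                            ∎

-- Arithmetic and the theorem

n≡E+m+2 : ∀ {n m E} → m + (3 + E) ≡ suc n → n ≡ E + m + 2
n≡E+m+2 {m = m} {E} m+k≡1+n = suc-injective (trans (sym m+k≡1+n) (shuffle m E))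
  where
  shuffle : ∀ m E → m + (3 + E) ≡ suc (E + m + 2)
  shuffle = solve-∀

small-k-violates-counting-bound : ∀ {n m E} → E ≤ 2 → 2 ≤ m → m < n → n * E + 2 * m < 2 * n * m
small-k-violates-counting-bound {n} {m} {E} E≤2 2≤m m<n = begin-strict
  n * E + 2 * m  ≤⟨ +-monoˡ-≤ (2 * m) (*-monoʳ-≤ n E≤2) ⟩
  n * 2 + 2 * m  <⟨ +-monoʳ-< (n * 2) (*-monoʳ-< 2 m<n) ⟩
  n * 2 + 2 * n  ≡⟨ regroup n ⟩
  2 * n * 2      ≤⟨ *-monoʳ-≤ (2 * n) 2≤m ⟩
  2 * n * m      ∎
  where
  open ≤-Reasoning
  regroup : ∀ n → n * 2 + 2 * n ≡ 2 * n * 2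
  regroup = solve-∀

counting-bound⇒quadratic : ∀ {n m E} → 3 ≤ E → 2 ≤ m → m + (3 + E) ≡ suc n →
  2 * n * m ≤ n * E + 2 * m → 2 * m * m + 3 * m + 2 ≤ E * E + 2 * E
counting-bound⇒quadratic {m = m} {E} 3≤E 2≤m m+k≡1+n bound with n≡E+m+2 m+k≡1+n
... | refl = +-cancelʳ-≤ (E * m + 2 * m) _ _ (begin
  2 * m * m + 3 * m + 2 + (E * m + 2 * m)          ≡⟨ split-m+2 m E ⟩
  2 * m * m + 2 * m + (m + 2) + (E * m + 2 * m)
    ≤⟨ +-monoˡ-≤ (E * m + 2 * m) (+-monoʳ-≤ (2 * m * m + 2 * m) m+2≤Em) ⟩
  2 * m * m + 2 * m + E * m + (E * m + 2 * m)      ≡⟨ expand-lhs m E ⟩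
  2 * (E + m + 2) * m                              ≤⟨ bound ⟩
  (E + m + 2) * E + 2 * m                          ≡⟨ expand-rhs m E ⟩
  E * E + 2 * E + (E * m + 2 * m)                  ∎)
  where
  open ≤-Reasoning
  m+2≤Em : m + 2 ≤ E * m
  m+2≤Em = begin
    m + 2      ≤⟨ +-monoʳ-≤ m 2≤m ⟩
    m + m      ≤⟨ m≤m+n (m + m) m ⟩
    m + m + m  ≡⟨ triple m ⟩
    3 * m      ≤⟨ *-monoˡ-≤ m 3≤E ⟩
    E * m      ∎
    where
    triple : ∀ m → m + m + m ≡ 3 * m
    triple = solve-∀
  split-m+2 : ∀ m E →
    2 * m * m + 3 * m + 2 + (E * m + 2 * m) ≡ 2 * m * m + 2 * m + (m + 2) + (E * m + 2 * m)
  split-m+2 = solve-∀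
  expand-lhs : ∀ m E → 2 * m * m + 2 * m + E * m + (E * m + 2 * m) ≡ 2 * (E + m + 2) * m
  expand-lhs = solve-∀
  expand-rhs : ∀ m E → (E + m + 2) * E + 2 * m ≡ E * E + 2 * E + (E * m + 2 * m)
  expand-rhs = solve-∀

quadratic⇒square-bound : ∀ {n m E} → m + (3 + E) ≡ suc n → 2 * m * m + 3 * m + 2 ≤ E * E + 2 * E →
  (4 * n ∸ (4 * suc E + 1)) ^ 2 < 8 * suc E ^ 2
quadratic⇒square-bound {m = m} {E} m+k≡1+n core with n≡E+m+2 m+k≡1+n
... | refl = begin-strict
  (4 * (E + m + 2) ∸ (4 * suc E + 1)) ^ 2  ≡⟨ cong (_^ 2) gap ⟩
  (4 * m + 3) ^ 2                          <⟨ m<m+n _ z<s ⟩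
  (4 * m + 3) ^ 2 + 7                      ≡⟨ square-lhs m ⟩
  8 * (2 * m * m + 3 * m + 2)              ≤⟨ *-monoʳ-≤ 8 core ⟩
  8 * (E * E + 2 * E)                      <⟨ m<m+n _ z<s ⟩
  8 * (E * E + 2 * E) + 8                  ≡⟨ square-rhs E ⟩
  8 * suc E ^ 2                            ∎
  where
  open ≤-Reasoning
  split-4n : ∀ m E → 4 * (E + m + 2) ≡ (4 * suc E + 1) + (4 * m + 3)
  split-4n = solve-∀
  gap : 4 * (E + m + 2) ∸ (4 * suc E + 1) ≡ 4 * m + 3
  gap = trans (cong (_∸ (4 * suc E + 1)) (split-4n m E)) (m+n∸m≡n (4 * suc E + 1) (4 * m + 3))
  -- x ^ 2 is x * (x * 1) by definition; the ring solver does not accept _^_.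
  square-lhs : ∀ m → (4 * m + 3) * ((4 * m + 3) * 1) + 7 ≡ 8 * (2 * m * m + 3 * m + 2)
  square-lhs = solve-∀
  square-rhs : ∀ E → 8 * (E * E + 2 * E) + 8 ≡ 8 * (suc E * (suc E * 1))
  square-rhs = solve-∀

7≤E*E+2*E : ∀ {E} → 3 ≤ E → 7 ≤ E * E + 2 * E
7≤E*E+2*E 3≤E = ≤-trans (m≤m+n 7 8) (+-mono-≤ (*-mono-≤ 3≤E 3≤E) (*-monoʳ-≤ 2 3≤E))

Gr-empty-for-small-k : ∀ {n k} → k ≤ 5 → k < n → ¬ GrNonempty n k 2
Gr-empty-for-small-k {n} {k} k≤5 k<n (G , G∈Gr) =
  let m+2≤n , bound = counting-bound G G∈Gr m+k≡1+n 2≤m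
  in <⇒≱ (small-k-violates-counting-bound (∸-monoˡ-≤ 3 k≤5) 2≤m (≤-trans (m<m+n m z<s) m+2≤n)) bound
  where
  m = suc n ∸ k
  m+k≡1+n : m + k ≡ suc n
  m+k≡1+n = m∸n+n≡m (m≤n⇒m≤1+n (<⇒≤ k<n))
  2≤m : 2 ≤ m
  2≤m = m+n≤o⇒m≤o∸n 2 (s≤s k<n)

Gr-large-k-bound : ∀ {E n} → 3 ≤ E → 3 + E ≤ n → GrNonempty n (3 + E) 2 →
  (4 * n ∸ (4 * suc E + 1)) ^ 2 < 8 * suc E ^ 2
Gr-large-k-bound {E} {n} 3≤E k≤n (G , G∈Gr) with m≤n⇒m<n∨m≡n k≤n
... | inj₂ refl = quadratic⇒square-bound {m = 1} {E} refl (7≤E*E+2*E 3≤E)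
... | inj₁ k<n  = quadratic⇒square-bound m+k≡1+n
  (counting-bound⇒quadratic 3≤E 2≤m m+k≡1+n (proj₂ (counting-bound G G∈Gr m+k≡1+n 2≤m)))
  where
  m = suc n ∸ (3 + E)
  m+k≡1+n : m + (3 + E) ≡ suc n
  m+k≡1+n = m∸n+n≡m (m≤n⇒m≤1+n k≤n)
  2≤m : 2 ≤ m
  2≤m = m+n≤o⇒m≤o∸n 2 (s≤s k<n)

theorem38 :
    (∀ (k : ℕ) → 1 ≤ k → k ≤ 5 →
       GrNonempty k k 2 × (∀ (n : ℕ) → k < n → ¬ GrNonempty n k 2))
    × (∀ (k : ℕ) → 6 ≤ k → ∀ (n : ℕ) → k ≤ n → GrNonempty n k 2 →
         (4 * n < 4 * (k ∸ 2) + 1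
          ⊎ (4 * n ∸ (4 * (k ∸ 2) + 1)) ^ 2 < 8 * (k ∸ 2) ^ 2))
theorem38 =
    (λ k _ k≤5 → (edgeless k , edgeless∈Gr k) , λ n k<n → Gr-empty-for-small-k k≤5 k<n)
  , λ { (suc (suc (suc E))) (s≤s (s≤s (s≤s 3≤E))) n k≤n G∈Gr → inj₂ (Gr-large-k-bound 3≤E k≤n G∈Gr) }
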